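{- Let $n$ be a product of more than two distinct primes, $n=p_1p_2\cdots p_m$ with $m>2$. Let $G_2$ be the induced subgraph of the comaximal graph $\Gamma(\mathbb{Z}_n)$ on the set of nonzero non-units of $\mathbb{Z}_n$. Then the complement $G_2^c$ of $G_2$ is connected.
   Context: The comaximal graph $\Gamma(\mathbb{Z}_n)$ has vertex set $\mathbb{Z}_n=\{0,1,\dots,n-1\}$, distinct $x,y$ adjacent iff $\langle x\rangle+\langle y\rangle=\mathbb{Z}_n$. The non-units of $\mathbb{Z}_n$ are the $a$ with $\gcd(a,n)\neq1$. $G_2^c$ has the same vertices as $G_2$, two distinct vertices adjacent iff they are not adjacent in $G_2$. -}

module Defs where

open import Data.Nat using (ℕ; zero; suc; _+_; _*_; _<_; NonZero)
open import Data.Nat.DivMod using (_%_)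
open import Data.Nat.GCD using (gcd)
open import Data.Product using (Σ; ∃; _×_; _,_)
open import Relation.Binary.PropositionalEquality using (_≡_; _≢_)
open import Relation.Nullary using (¬_)

-- x and y are comaximal in ℤ_n : ⟨x⟩ + ⟨y⟩ = ℤ_n, i.e. 1 ∈ ⟨x⟩ + ⟨y⟩,
-- i.e. there are u v with u*x + v*y ≡ 1 (mod n).
Comaximal : (n : ℕ) → .{{NonZero n}} → ℕ → ℕ → Set
Comaximal n x y = ∃ λ u → ∃ λ v → (u * x + v * y) % n ≡ 1 % n

ΓAdj : (n : ℕ) → .{{NonZero n}} → ℕ → ℕ → Set
ΓAdj n x y = x ≢ y × Comaximal n x y

IsG₂Vertex : ℕ → ℕ → Set
IsG₂Vertex n a = a < n × a ≢ 0 × gcd a n ≢ 1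

G₂ᶜAdj : (n : ℕ) → .{{NonZero n}} → ℕ → ℕ → Set
G₂ᶜAdj n x y = IsG₂Vertex n x × IsG₂Vertex n y × x ≢ y × ¬ ΓAdj n x y

data G₂ᶜWalk (n : ℕ) .{{_ : NonZero n}} : ℕ → ℕ → Set where
  here : ∀ {x} → G₂ᶜWalk n x x
  step : ∀ {x y z} → G₂ᶜAdj n x y → G₂ᶜWalk n y z → G₂ᶜWalk n x z

G₂ᶜConnected : (n : ℕ) → .{{NonZero n}} → Set
G₂ᶜConnected n = ∀ x y → IsG₂Vertex n x → IsG₂Vertex n y → G₂ᶜWalk n x y

-- Write n = p·q·s with p, q prime and s ≠ 1. Two nonzero non-units sharing a
-- nontrivial divisor of n are never comaximal, so they are adjacent in G₂ᶜ.
-- Take the hub n/q = p·s. A vertex divisible by p is adjacent to it; any other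
-- vertex x has gcd(x, n) ≠ 1 coprime to p, so gcd(x, n) divides n/p = q·s and
-- x is adjacent to q·s, which shares s with the hub. Hence every vertex is
-- within distance two of the hub.
module Submission where

open import Defs
open import Data.Nat using (ℕ; _<_; NonZero)
open import Data.List using (List; length)
open import Data.Nat.ListAction using (product)
open import Data.List.Relation.Unary.All using (All)
open import Data.List.Relation.Unary.Unique.Propositional using (Unique)
open import Data.Nat.Primality using (Prime)
open import Relation.Binary.PropositionalEquality using (_≡_)

open import Data.Nat using (_*_; _%_; _≟_; z≤n; s≤s; nonTrivial⇒n>1; nonTrivial⇒≢1; ≢-nonZero; ≢-nonZero⁻¹)
open import Data.Nat.Properties using (+-comm; *-comm; *-zeroʳ; m<m*n)
open import Data.Nat.Divisibility
open import Data.Nat.GCD using (gcd; gcd[m,n]∣m; gcd[m,n]∣n; gcd-greatest)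
open import Data.Nat.Coprimality using (Coprime; coprime-divisor)
open import Data.Nat.Primality using (prime⇒irreducible; prime⇒nonTrivial)
open import Data.List using (_∷_)
open import Data.List.Relation.Unary.All using (_∷_)
open import Data.Product using (_,_)
open import Data.Sum using (inj₁; inj₂)
open import Function using (_∘_)
open import Relation.Nullary using (¬_; yes; no; contradiction)
open import Relation.Binary.PropositionalEquality using (_≢_; refl; sym; trans; cong; subst; ≢-sym)
open import Algebra.Properties.CommutativeSemigroup Data.Nat.Properties.*-commutativeSemigroup
  using (x∙yz≈y∙xz)

prime⇒≢1 : ∀ {p} → Prime p → p ≢ 1
prime⇒≢1 pp = nonTrivial⇒≢1 {{prime⇒nonTrivial pp}}

prime⇒>1 : ∀ {p} → Prime p → 1 < p
prime⇒>1 pp = nonTrivial⇒n>1 _ {{prime⇒nonTrivial pp}}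

module _ (n : ℕ) .{{_ : NonZero n}} where

  ΓAdj-sym : ∀ {x y} → ΓAdj n x y → ΓAdj n y x
  ΓAdj-sym (x≢y , u , v , eq) = ≢-sym x≢y , v , u , trans (cong (_% n) (+-comm (v * _) (u * _))) eq

  G₂ᶜAdj-sym : ∀ {x y} → G₂ᶜAdj n x y → G₂ᶜAdj n y x
  G₂ᶜAdj-sym (vx , vy , x≢y , ¬adj) = vy , vx , ≢-sym x≢y , ¬adj ∘ ΓAdj-sym

  G₂ᶜWalk-trans : ∀ {x y z} → G₂ᶜWalk n x y → G₂ᶜWalk n y z → G₂ᶜWalk n x z
  G₂ᶜWalk-trans here        w = w
  G₂ᶜWalk-trans (step e w₁) w = step e (G₂ᶜWalk-trans w₁ w)

  G₂ᶜWalk-sym : ∀ {x y} → G₂ᶜWalk n x y → G₂ᶜWalk n y x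
  G₂ᶜWalk-sym here       = here
  G₂ᶜWalk-sym (step e w) = G₂ᶜWalk-trans (G₂ᶜWalk-sym w) (step (G₂ᶜAdj-sym e) here)

  hub⇒G₂ᶜConnected : ∀ h → (∀ x → IsG₂Vertex n x → G₂ᶜWalk n x h) → G₂ᶜConnected n
  hub⇒G₂ᶜConnected h toHub x y vx vy = G₂ᶜWalk-trans (toHub x vx) (G₂ᶜWalk-sym (toHub y vy))

  common-divisor⇒¬ΓAdj : ∀ {d x y} → d ≢ 1 → d ∣ x → d ∣ y → d ∣ n → ¬ ΓAdj n x y
  common-divisor⇒¬ΓAdj d≢1 d∣x d∣y d∣n (_ , u , v , eq) =
    d≢1 (∣1⇒≡1 (∣n∣m%n⇒∣m d∣n (subst (_ ∣_) eq
      (%-presˡ-∣ (∣m∣n⇒∣m+n (∣n⇒∣m*n u d∣x) (∣n⇒∣m*n v d∣y)) d∣n))))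

  common-divisor⇒G₂ᶜWalk : ∀ {d x y} → IsG₂Vertex n x → IsG₂Vertex n y →
                            d ≢ 1 → d ∣ x → d ∣ y → d ∣ n → G₂ᶜWalk n x y
  common-divisor⇒G₂ᶜWalk {x = x} {y} vx vy d≢1 d∣x d∣y d∣n with x ≟ y
  ... | yes refl = here
  ... | no x≢y   = step (vx , vy , x≢y , common-divisor⇒¬ΓAdj d≢1 d∣x d∣y d∣n) here

  cofactor-IsG₂Vertex : ∀ {k h d} → 1 < k → k * h ≡ n → d ≢ 1 → d ∣ h → IsG₂Vertex n h
  cofactor-IsG₂Vertex {k} {h} {d} 1<k kh≡n d≢1 d∣h =
    subst (h <_) (trans (*-comm h k) kh≡n) (m<m*n h k {{h-nonZero}} 1<k) ,
    h≢0 ,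
    λ g≡1 → d≢1 (∣1⇒≡1 (subst (d ∣_) g≡1 (gcd-greatest d∣h (subst (d ∣_) kh≡n (∣n⇒∣m*n k d∣h)))))
    where
    h≢0 : h ≢ 0
    h≢0 refl = ≢-nonZero⁻¹ n (trans (sym kh≡n) (*-zeroʳ k))
    h-nonZero : NonZero h
    h-nonZero = ≢-nonZero h≢0

  prime∤⇒coprime : ∀ {p m} → Prime p → ¬ p ∣ m → Coprime m p
  prime∤⇒coprime pp p∤m (d∣m , d∣p) with prime⇒irreducible pp d∣p
  ... | inj₁ d≡1 = d≡1
  ... | inj₂ refl = contradiction d∣m p∤m

  gcd∣cofactor : ∀ {p m x} → Prime p → ¬ p ∣ x → p * m ≡ n → gcd x n ∣ m
  gcd∣cofactor {x = x} pp p∤x pm≡n = coprime-divisor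
    (prime∤⇒coprime pp λ p∣g → p∤x (∣-trans p∣g (gcd[m,n]∣m x n)))
    (subst (gcd x n ∣_) (sym pm≡n) (gcd[m,n]∣n x n))

  G₂ᶜWalk-to-cofactor : ∀ {p m x} → Prime p → p * m ≡ n → IsG₂Vertex n m →
                        IsG₂Vertex n x → ¬ p ∣ x → G₂ᶜWalk n x m
  G₂ᶜWalk-to-cofactor {x = x} pp pm≡n vm vx@(_ , _ , g≢1) p∤x =
    common-divisor⇒G₂ᶜWalk vx vm g≢1 (gcd[m,n]∣m x n) (gcd∣cofactor pp p∤x pm≡n) (gcd[m,n]∣n x n)

  primes-times-nontrivial⇒G₂ᶜConnected : ∀ {p q s} → Prime p → Prime q → s ≢ 1 →
                                         p * (q * s) ≡ n → G₂ᶜConnected n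
  primes-times-nontrivial⇒G₂ᶜConnected {p} {q} {s} pp pq s≢1 pqs≡n =
    hub⇒G₂ᶜConnected (p * s) toHub
    where
    qps≡n : q * (p * s) ≡ n
    qps≡n = trans (x∙yz≈y∙xz q p s) pqs≡n
    s∣qs : s ∣ q * s
    s∣qs = n∣m*n q
    s∣ps : s ∣ p * s
    s∣ps = n∣m*n p
    s∣n : s ∣ n
    s∣n = subst (s ∣_) pqs≡n (∣n⇒∣m*n p s∣qs)
    p∣n : p ∣ n
    p∣n = subst (p ∣_) pqs≡n (m∣m*n (q * s))
    vqs : IsG₂Vertex n (q * s)
    vqs = cofactor-IsG₂Vertex (prime⇒>1 pp) pqs≡n s≢1 s∣qs
    vps : IsG₂Vertex n (p * s)
    vps = cofactor-IsG₂Vertex (prime⇒>1 pq) qps≡n s≢1 s∣ps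
    toHub : ∀ x → IsG₂Vertex n x → G₂ᶜWalk n x (p * s)
    toHub x vx with p ∣? x
    ... | yes p∣x = common-divisor⇒G₂ᶜWalk vx vps (prime⇒≢1 pp) p∣x (m∣m*n s) p∣n
    ... | no p∤x  = G₂ᶜWalk-trans (G₂ᶜWalk-to-cofactor pp pqs≡n vqs vx p∤x)
                      (common-divisor⇒G₂ᶜWalk vqs vps s≢1 s∣qs s∣ps s∣n)

prime*n≢1 : ∀ {p r} → Prime p → p * r ≢ 1
prime*n≢1 {p} {r} pp pr≡1 = prime⇒≢1 pp (∣1⇒≡1 (subst (p ∣_) pr≡1 (m∣m*n r)))

-- The primes need not be distinct.
theorem5p2 : (n : ℕ) .{{_ : NonZero n}} (ps : List ℕ) → All Prime ps → Unique ps → 2 < length ps → product ps ≡ n → G₂ᶜConnected n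
theorem5p2 n (p ∷ q ∷ r ∷ _) (pp ∷ pq ∷ pr ∷ _) _ (s≤s (s≤s (s≤s z≤n))) prod≡n =
  primes-times-nontrivial⇒G₂ᶜConnected n pp pq (prime*n≢1 pr) prod≡n
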